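{- $\mathrm{ex}(n,\{\text{bat},\text{nested},\text{ears}\})\in\Theta(n^2)$.
   Context: Let $P$ be a set of $n$ points in convex position in the plane (the vertices of a convex $n$-gon); a triangle on $P$ is a 3-element subset of $P$. For two distinct triangles $t_1,t_2$ on $P$, label each point of $t_1\cup t_2$ by the triangle(s) containing it and read the points in their cyclic order around the polygon. The pair forms exactly one of eight configurations. (i) If $t_1,t_2$ share two vertices $u,v$: "taco" if their third vertices lie on the same side of the line $uv$, "mariposa" if on opposite sides. (ii) If they share exactly one vertex $v$: read the remaining four vertices in cyclic order starting just after $v$; "bat" if the pattern is $t_1t_1t_2t_2$ or $t_2t_2t_1t_1$, "nested" if it is $t_1t_2t_2t_1$ or $t_2t_1t_1t_2$, "crossing" if it is $t_1t_2t_1t_2$ or $t_2t_1t_2t_1$. (iii) If they share no vertex, the cyclic sequence of the six labels is, up to rotation, reflection and exchanging the roles of $t_1,t_2$, one of: "ears" $AAABBB$, "swords" $AABABB$, "david" $ABABAB$. For a set $X$ of configurations, $\mathrm{ex}(n,X)$ is the maximum size of a family of triangles on $P$ in which no two triangles form a configuration belonging to $X$ (this depends only on $n$ and $X$). -}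

module Defs where

open import Data.Nat using (ℕ; _≤_; _*_)
open import Data.Bool using (Bool; true; false)
open import Data.Maybe using (Maybe; just; nothing)
open import Data.Fin using (Fin)
open import Data.Fin.Subset using (Subset; ∣_∣)
open import Data.Vec using (lookup)
open import Data.List using (List; []; _∷_; _++_; mapMaybe; allFin; length)
open import Data.List.Membership.Propositional using (_∈_)
open import Data.List.Relation.Unary.Unique.Propositional using (Unique)
open import Data.Product using (Σ; ∃; ∃-syntax; _×_; _,_)
open import Data.Sum using (_⊎_)
open import Relation.Binary.PropositionalEquality using (_≡_; _≢_)
open import Relation.Nullary using (¬_)

-- The n points in convex position are identified with Fin n, listed in
-- their cyclic order around the polygon (0,1,...,n-1, then back to 0).
-- Only the cyclic order matters for all configurations.

Triangle : ℕ → Set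
Triangle n = Σ (Subset n) λ s → ∣ s ∣ ≡ 3

-- Labels of points in t1 ∪ t2: only in t1, only in t2, or in both.
data Lab : Set where
  L1 L2 LB : Lab

label : Bool → Bool → Maybe Lab
label true  true  = just LB
label true  false = just L1
label false true  = just L2
label false false = nothing

-- Labels of the points of t1 ∪ t2, read in the order 0,1,...,n-1
-- (a linear reading of the cyclic order).
labels : ∀ {n} → Triangle n → Triangle n → List Lab
labels {n} (s₁ , _) (s₂ , _) =
  mapMaybe (λ i → label (lookup s₁ i) (lookup s₂ i)) (allFin n)

-- Exactly one shared vertex v (the unique LB), and the remaining four
-- labels read cyclically starting just after v are ys ++ xs.
after-shared : ∀ {n} → Triangle n → Triangle n → List Lab → Set
after-shared t₁ t₂ pat =
  ∃[ xs ] ∃[ ys ] (labels t₁ t₂ ≡ xs ++ LB ∷ ys × ys ++ xs ≡ pat)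

Bat : ∀ {n} → Triangle n → Triangle n → Set
Bat t₁ t₂ = after-shared t₁ t₂ (L1 ∷ L1 ∷ L2 ∷ L2 ∷ [])
          ⊎ after-shared t₁ t₂ (L2 ∷ L2 ∷ L1 ∷ L1 ∷ [])

Nested : ∀ {n} → Triangle n → Triangle n → Set
Nested t₁ t₂ = after-shared t₁ t₂ (L1 ∷ L2 ∷ L2 ∷ L1 ∷ [])
             ⊎ after-shared t₁ t₂ (L2 ∷ L1 ∷ L1 ∷ L2 ∷ [])

-- Disjoint triangles whose cyclic label sequence is a rotation of
-- AAABBB (this set of rotations is closed under reflection and under
-- exchanging t1,t2, since BBBAAA is itself a rotation of AAABBB).
Ears : ∀ {n} → Triangle n → Triangle n → Set
Ears t₁ t₂ = ∃[ xs ] ∃[ ys ]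
  (labels t₁ t₂ ≡ xs ++ ys × ys ++ xs ≡ L1 ∷ L1 ∷ L1 ∷ L2 ∷ L2 ∷ L2 ∷ [])

Forbidden : ∀ {n} → Triangle n → Triangle n → Set
Forbidden t₁ t₂ = Bat t₁ t₂ ⊎ Nested t₁ t₂ ⊎ Ears t₁ t₂

Admissible : ∀ {n} → List (Triangle n) → Set
Admissible F = Unique F
  × (∀ {t₁ t₂} → t₁ ∈ F → t₂ ∈ F → t₁ ≢ t₂ → ¬ Forbidden t₁ t₂)

module Submission where

-- Whether a label sequence forms a bat, nested pair or ears is a
-- question about its finitely many rotations, hence decidable.
--
-- Write n = 3m + r and cut off three blocks of m points.
-- The triangles {i, m + j, 2m + j} (i, j < m) pairwise read as X ++ Y ++ Y,
-- where X and Y are the label sequences of two points inside one block;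
-- a finite check shows that none of these is forbidden.  This gives
-- m² ≥ n²/36 triangles.
--
-- The label sequence of two triangles is the merge of their
-- sorted vertex lists.  Give the triangle a < b < c the key (a, b + c).
-- Distinct triangles with the same key share a and satisfy
-- b < b' < c' < c, so they are nested.  Hence the members of an admissible
-- family have distinct keys, and there are at most n · 2n of them.

open import Defs
open import Data.Nat using (ℕ; zero; suc; _+_; _*_; _≤_; _<_; _≤?_; z≤n; s≤s; _/_; _%_)
open import Data.Nat.Properties
open import Data.Nat.DivMod using (m≡m%n+[m/n]*n; m%n<n)
open import Data.Nat.Solver using (module +-*-Solver)
open import Data.Bool using (Bool; true; false)
open import Data.Maybe using (Maybe)
open import Data.Product using (∃-syntax; _×_; _,_; proj₁; proj₂)
open import Data.Sum using (inj₁; inj₂)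
open import Data.Empty using (⊥-elim)
open import Data.Fin as Fin using (Fin; fromℕ<; combine)
open import Data.Fin.Properties using (pigeonhole; fromℕ<-injective; combine-injective)
open import Data.Fin.Subset using (Subset; ∣_∣; ⁅_⁆) renaming (⊥ to ∅; _∈_ to _∈ₛ_)
open import Data.Fin.Subset.Properties using (∣⊥∣≡0; ∣⁅x⁆∣≡1; x∈⁅x⁆; x∈⁅y⁆⇒x≡y)
open import Data.Vec as Vec using (Vec; []; _∷_)
open import Data.Vec.Properties using (++-injective; ++-injectiveˡ)
open import Data.List using (List; []; _∷_; _++_; length; map; replicate; tabulate; allFin; lookup; catMaybes; cartesianProductWith)
open import Data.List.Properties using (≡-dec; ∷-injectiveʳ; map-tabulate; length-tabulate; length-++; length-map; ++-identityʳ)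
open import Data.List.Relation.Unary.All as All using (All; []; _∷_)
open import Data.List.Relation.Unary.AllPairs using (AllPairs; []; _∷_)
open import Data.List.Relation.Unary.Any using (Any; here; there; any?)
open import Data.List.Relation.Unary.Unique.Propositional using (Unique)
open import Data.List.Relation.Unary.Unique.Propositional.Properties using (cartesianProductWith⁺; allFin⁺)
open import Data.List.Membership.Propositional using (_∈_)
open import Data.List.Membership.Propositional.Properties using (∈-lookup; ∈-cartesianProductWith⁻)
open import Function using (id; _∘_)
open import Relation.Binary using (DecidableEquality; tri<; tri≈; tri>)
open import Relation.Nullary using (¬_; Dec; yes; no; contradiction)
open import Relation.Nullary.Decidable using (from-no)
open import Relation.Binary.PropositionalEquality using (_≡_; _≢_; refl; sym; trans; cong; cong₂; subst; module ≡-Reasoning)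
open ≡-Reasoning

labelSeq : ∀ {n} → Vec Bool n → Vec Bool n → List Lab
labelSeq []          []          = []
labelSeq (true  ∷ u) (true  ∷ v) = LB ∷ labelSeq u v
labelSeq (true  ∷ u) (false ∷ v) = L1 ∷ labelSeq u v
labelSeq (false ∷ u) (true  ∷ v) = L2 ∷ labelSeq u v
labelSeq (false ∷ u) (false ∷ v) = labelSeq u v

catMaybes-labels : ∀ {n} (u v : Vec Bool n) →
  catMaybes (tabulate (λ i → label (Vec.lookup u i) (Vec.lookup v i))) ≡ labelSeq u v
catMaybes-labels []          []          = refl
catMaybes-labels (true  ∷ u) (true  ∷ v) = cong (LB ∷_) (catMaybes-labels u v)
catMaybes-labels (true  ∷ u) (false ∷ v) = cong (L1 ∷_) (catMaybes-labels u v)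
catMaybes-labels (false ∷ u) (true  ∷ v) = cong (L2 ∷_) (catMaybes-labels u v)
catMaybes-labels (false ∷ u) (false ∷ v) = catMaybes-labels u v

labels≡labelSeq : ∀ {n} (t₁ t₂ : Triangle n) → labels t₁ t₂ ≡ labelSeq (proj₁ t₁) (proj₁ t₂)
labels≡labelSeq {n} (u , _) (v , _) = begin
  catMaybes (map entry (allFin n)) ≡⟨ cong catMaybes (map-tabulate id entry) ⟩
  catMaybes (tabulate entry)       ≡⟨ catMaybes-labels u v ⟩
  labelSeq u v                     ∎
  where
  entry : Fin n → Maybe Lab
  entry i = label (Vec.lookup u i) (Vec.lookup v i)

labelSeq-++ : ∀ {m n} (u₁ v₁ : Vec Bool m) (u₂ v₂ : Vec Bool n) →
  labelSeq (u₁ Vec.++ u₂) (v₁ Vec.++ v₂) ≡ labelSeq u₁ v₁ ++ labelSeq u₂ v₂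
labelSeq-++ []          []          u₂ v₂ = refl
labelSeq-++ (true  ∷ u) (true  ∷ v) u₂ v₂ = cong (LB ∷_) (labelSeq-++ u v u₂ v₂)
labelSeq-++ (true  ∷ u) (false ∷ v) u₂ v₂ = cong (L1 ∷_) (labelSeq-++ u v u₂ v₂)
labelSeq-++ (false ∷ u) (true  ∷ v) u₂ v₂ = cong (L2 ∷_) (labelSeq-++ u v u₂ v₂)
labelSeq-++ (false ∷ u) (false ∷ v) u₂ v₂ = labelSeq-++ u v u₂ v₂

Rotation : List Lab → List Lab → Set
Rotation l p = ∃[ xs ] ∃[ ys ] (l ≡ xs ++ ys × ys ++ xs ≡ p)

forbiddenCycles : List (List Lab)
forbiddenCycles =
  (LB ∷ L1 ∷ L1 ∷ L2 ∷ L2 ∷ []) ∷ (LB ∷ L2 ∷ L2 ∷ L1 ∷ L1 ∷ []) ∷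
  (LB ∷ L1 ∷ L2 ∷ L2 ∷ L1 ∷ []) ∷ (LB ∷ L2 ∷ L1 ∷ L1 ∷ L2 ∷ []) ∷
  (L1 ∷ L1 ∷ L1 ∷ L2 ∷ L2 ∷ L2 ∷ []) ∷ []

after-shared⇒rotation : ∀ {n} (t₁ t₂ : Triangle n) {p} →
  after-shared t₁ t₂ p → Rotation (labels t₁ t₂) (LB ∷ p)
after-shared⇒rotation _ _ (xs , ys , split , rotated) = xs , LB ∷ ys , split , cong (LB ∷_) rotated

forbidden⇒rotation : ∀ {n} (t₁ t₂ : Triangle n) →
  Forbidden t₁ t₂ → Any (Rotation (labels t₁ t₂)) forbiddenCycles
forbidden⇒rotation t₁ t₂ (inj₁ (inj₁ bat))         = here (after-shared⇒rotation t₁ t₂ bat)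
forbidden⇒rotation t₁ t₂ (inj₁ (inj₂ bat))         = there (here (after-shared⇒rotation t₁ t₂ bat))
forbidden⇒rotation t₁ t₂ (inj₂ (inj₁ (inj₁ nest))) = there (there (here (after-shared⇒rotation t₁ t₂ nest)))
forbidden⇒rotation t₁ t₂ (inj₂ (inj₁ (inj₂ nest))) = there (there (there (here (after-shared⇒rotation t₁ t₂ nest))))
forbidden⇒rotation t₁ t₂ (inj₂ (inj₂ ears))        = there (there (there (there (here ears))))

split? : ∀ {A : Set} {R : List A → List A → Set} → (∀ xs ys → Dec (R xs ys)) →
  ∀ l → Dec (∃[ xs ] ∃[ ys ] (l ≡ xs ++ ys × R xs ys))
split? R? [] with R? [] []
... | yes r = yes ([] , [] , refl , r)
... | no ¬r = no λ { ([] , [] , refl , r) → ¬r r ; ([] , _ ∷ _ , () , _) ; (_ ∷ _ , _ , () , _) }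
split? R? (x ∷ l) with R? [] (x ∷ l) | split? (λ xs → R? (x ∷ xs)) l
... | yes r  | _                        = yes ([] , x ∷ l , refl , r)
... | no _   | yes (xs , ys , refl , r) = yes (x ∷ xs , ys , refl , r)
... | no ¬r  | no ¬s                    = no λ
  { ([] , _ , refl , r)      → ¬r r
  ; (_ ∷ xs , ys , refl , r) → ¬s (xs , ys , refl , r) }

_≟ˡ_ : DecidableEquality Lab
L1 ≟ˡ L1 = yes refl
L1 ≟ˡ L2 = no λ ()
L1 ≟ˡ LB = no λ ()
L2 ≟ˡ L1 = no λ ()
L2 ≟ˡ L2 = yes refl
L2 ≟ˡ LB = no λ ()
LB ≟ˡ L1 = no λ ()
LB ≟ˡ L2 = no λ ()
LB ≟ˡ LB = yes refl

rotation? : ∀ l p → Dec (Rotation l p)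
rotation? l p = split? (λ xs ys → ≡-dec _≟ˡ_ (ys ++ xs) p) l

forbidden? : ∀ l → Dec (Any (Rotation l) forbiddenCycles)
forbidden? l = any? (rotation? l) forbiddenCycles

¬forbidden : ∀ {n} (t₁ t₂ : Triangle n) {l} → labels t₁ t₂ ≡ l →
  ¬ Any (Rotation l) forbiddenCycles → ¬ Forbidden t₁ t₂
¬forbidden t₁ t₂ reads-l safe forbidden =
  safe (subst (λ l → Any (Rotation l) forbiddenCycles) reads-l (forbidden⇒rotation t₁ t₂ forbidden))

data Order : Set where
  before same after : Order

compareFin : ∀ {m} → Fin m → Fin m → Order
compareFin Fin.zero    Fin.zero    = same
compareFin Fin.zero    (Fin.suc _) = before
compareFin (Fin.suc _) Fin.zero    = after
compareFin (Fin.suc i) (Fin.suc j) = compareFin i j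

compareFin-same : ∀ {m} (i j : Fin m) → compareFin i j ≡ same → i ≡ j
compareFin-same Fin.zero    Fin.zero    _  = refl
compareFin-same (Fin.suc i) (Fin.suc j) eq = cong Fin.suc (compareFin-same i j eq)

orderLabels : Order → List Lab
orderLabels before = L1 ∷ L2 ∷ []
orderLabels same   = LB ∷ []
orderLabels after  = L2 ∷ L1 ∷ []

labelSeq-∅ : ∀ n → labelSeq (∅ {n}) ∅ ≡ []
labelSeq-∅ zero    = refl
labelSeq-∅ (suc n) = labelSeq-∅ n

labelSeq-∅ˡ : ∀ {n} (v : Subset n) → labelSeq ∅ v ≡ replicate ∣ v ∣ L2
labelSeq-∅ˡ []          = refl
labelSeq-∅ˡ (true  ∷ v) = cong (L2 ∷_) (labelSeq-∅ˡ v)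
labelSeq-∅ˡ (false ∷ v) = labelSeq-∅ˡ v

labelSeq-∅ʳ : ∀ {n} (u : Subset n) → labelSeq u ∅ ≡ replicate ∣ u ∣ L1
labelSeq-∅ʳ []          = refl
labelSeq-∅ʳ (true  ∷ u) = cong (L1 ∷_) (labelSeq-∅ʳ u)
labelSeq-∅ʳ (false ∷ u) = labelSeq-∅ʳ u

singleton-labels : ∀ {m} (i j : Fin m) → labelSeq ⁅ i ⁆ ⁅ j ⁆ ≡ orderLabels (compareFin i j)
singleton-labels {suc m} Fin.zero Fin.zero = cong (LB ∷_) (labelSeq-∅ m)
singleton-labels Fin.zero (Fin.suc j) =
  cong (L1 ∷_) (trans (labelSeq-∅ˡ ⁅ j ⁆) (cong (λ k → replicate k L2) (∣⁅x⁆∣≡1 j)))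
singleton-labels (Fin.suc i) Fin.zero =
  cong (L2 ∷_) (trans (labelSeq-∅ʳ ⁅ i ⁆) (cong (λ k → replicate k L1) (∣⁅x⁆∣≡1 i)))
singleton-labels (Fin.suc i) (Fin.suc j) = singleton-labels i j

⁅⁆-injective : ∀ {m} {i j : Fin m} → ⁅ i ⁆ ≡ ⁅ j ⁆ → i ≡ j
⁅⁆-injective {i = i} {j} eq = x∈⁅y⁆⇒x≡y j (subst (i ∈ₛ_) eq (x∈⁅x⁆ i))

∣++∣ : ∀ {m n} (p : Subset m) (q : Subset n) → ∣ p Vec.++ q ∣ ≡ ∣ p ∣ + ∣ q ∣
∣++∣ []          q = refl
∣++∣ (true  ∷ p) q = cong suc (∣++∣ p q)
∣++∣ (false ∷ p) q = ∣++∣ p q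

∣⁅i⁆++∣ : ∀ {m n} (i : Fin m) (q : Subset n) → ∣ ⁅ i ⁆ Vec.++ q ∣ ≡ suc ∣ q ∣
∣⁅i⁆++∣ i q = trans (∣++∣ ⁅ i ⁆ q) (cong (_+ ∣ q ∣) (∣⁅x⁆∣≡1 i))

length-cartesianProductWith : ∀ {A B C : Set} (f : A → B → C) xs ys →
  length (cartesianProductWith f xs ys) ≡ length xs * length ys
length-cartesianProductWith f []       ys = refl
length-cartesianProductWith f (x ∷ xs) ys = begin
  length (map (f x) ys ++ cartesianProductWith f xs ys)         ≡⟨ length-++ (map (f x) ys) ⟩
  length (map (f x) ys) + length (cartesianProductWith f xs ys) ≡⟨ cong₂ _+_ (length-map (f x) ys)
                                                                    (length-cartesianProductWith f xs ys) ⟩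
  length ys + length xs * length ys                             ∎

blockLabels : Order → Order → List Lab
blockLabels x y = orderLabels x ++ orderLabels y ++ orderLabels y

blockLabels-safe : ∀ x y → ¬ (x ≡ same × y ≡ same) → ¬ Any (Rotation (blockLabels x y)) forbiddenCycles
blockLabels-safe before before _ = from-no (forbidden? (blockLabels before before))
blockLabels-safe before same   _ = from-no (forbidden? (blockLabels before same))
blockLabels-safe before after  _ = from-no (forbidden? (blockLabels before after))
blockLabels-safe same   before _ = from-no (forbidden? (blockLabels same before))
blockLabels-safe same   same   equal = ⊥-elim (equal (refl , refl))
blockLabels-safe same   after  _ = from-no (forbidden? (blockLabels same after))
blockLabels-safe after  before _ = from-no (forbidden? (blockLabels after before))
blockLabels-safe after  same   _ = from-no (forbidden? (blockLabels after same))
blockLabels-safe after  after  _ = from-no (forbidden? (blockLabels after after))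

module LowerBound (m r : ℕ) where

  n : ℕ
  n = m + (m + (m + r))

  vertexSet : Fin m → Fin m → Subset n
  vertexSet i j = ⁅ i ⁆ Vec.++ ⁅ j ⁆ Vec.++ ⁅ j ⁆ Vec.++ ∅ {r}

  vertexSet-size : ∀ i j → ∣ vertexSet i j ∣ ≡ 3
  vertexSet-size i j = begin
    ∣ ⁅ i ⁆ Vec.++ ⁅ j ⁆ Vec.++ ⁅ j ⁆ Vec.++ ∅ {r} ∣ ≡⟨ ∣⁅i⁆++∣ i _ ⟩
    1 + ∣ ⁅ j ⁆ Vec.++ ⁅ j ⁆ Vec.++ ∅ {r} ∣         ≡⟨ cong suc (∣⁅i⁆++∣ j _) ⟩
    2 + ∣ ⁅ j ⁆ Vec.++ ∅ {r} ∣                       ≡⟨ cong (2 +_) (∣⁅i⁆++∣ j _) ⟩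
    3 + ∣ ∅ {r} ∣                                    ≡⟨ cong (3 +_) (∣⊥∣≡0 r) ⟩
    3                                                ∎

  triangle : Fin m → Fin m → Triangle n
  triangle i j = vertexSet i j , vertexSet-size i j

  triangle-injective : ∀ {i i' j j'} → triangle i j ≡ triangle i' j' → i ≡ i' × j ≡ j'
  triangle-injective {i} {i'} {j} {j'} eq with ++-injective ⁅ i ⁆ ⁅ i' ⁆ (cong proj₁ eq)
  ... | first , rest = ⁅⁆-injective first , ⁅⁆-injective (++-injectiveˡ ⁅ j ⁆ ⁅ j' ⁆ rest)

  vertexSet-labels : ∀ i j i' j' → labelSeq (vertexSet i j) (vertexSet i' j')
                   ≡ labelSeq ⁅ i ⁆ ⁅ i' ⁆ ++ labelSeq ⁅ j ⁆ ⁅ j' ⁆ ++ labelSeq ⁅ j ⁆ ⁅ j' ⁆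
  vertexSet-labels i j i' j'
    rewrite labelSeq-++ ⁅ i ⁆ ⁅ i' ⁆ (⁅ j ⁆ Vec.++ ⁅ j ⁆ Vec.++ ∅ {r}) (⁅ j' ⁆ Vec.++ ⁅ j' ⁆ Vec.++ ∅ {r})
          | labelSeq-++ ⁅ j ⁆ ⁅ j' ⁆ (⁅ j ⁆ Vec.++ ∅ {r}) (⁅ j' ⁆ Vec.++ ∅ {r})
          | labelSeq-++ ⁅ j ⁆ ⁅ j' ⁆ (∅ {r}) ∅
          | labelSeq-∅ r
          | ++-identityʳ (labelSeq ⁅ j ⁆ ⁅ j' ⁆) = refl

  triangle-labels : ∀ i j i' j' →
    labels (triangle i j) (triangle i' j') ≡ blockLabels (compareFin i i') (compareFin j j')
  triangle-labels i j i' j' = begin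
    labels (triangle i j) (triangle i' j')
      ≡⟨ labels≡labelSeq (triangle i j) (triangle i' j') ⟩
    labelSeq (vertexSet i j) (vertexSet i' j')
      ≡⟨ vertexSet-labels i j i' j' ⟩
    labelSeq ⁅ i ⁆ ⁅ i' ⁆ ++ labelSeq ⁅ j ⁆ ⁅ j' ⁆ ++ labelSeq ⁅ j ⁆ ⁅ j' ⁆
      ≡⟨ cong₂ (λ x y → x ++ y ++ y) (singleton-labels i i') (singleton-labels j j') ⟩
    blockLabels (compareFin i i') (compareFin j j') ∎

  family : List (Triangle n)
  family = cartesianProductWith triangle (allFin m) (allFin m)

  family-length : length family ≡ m * m
  family-length = trans (length-cartesianProductWith triangle (allFin m) (allFin m))
                        (cong₂ _*_ (length-tabulate {n = m} id) (length-tabulate {n = m} id))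

  family-admissible : Admissible family
  family-admissible = cartesianProductWith⁺ triangle triangle-injective (allFin⁺ m) (allFin⁺ m) , not-forbidden
    where
    not-forbidden : ∀ {t₁ t₂} → t₁ ∈ family → t₂ ∈ family → t₁ ≢ t₂ → ¬ Forbidden t₁ t₂
    not-forbidden t₁∈ t₂∈ t₁≢t₂
      with ∈-cartesianProductWith⁻ triangle (allFin m) (allFin m) t₁∈
         | ∈-cartesianProductWith⁻ triangle (allFin m) (allFin m) t₂∈
    ... | i , j , _ , _ , refl | i' , j' , _ , _ , refl =
      ¬forbidden (triangle i j) (triangle i' j') (triangle-labels i j i' j') (blockLabels-safe (compareFin i i') (compareFin j j') not-equal)
      where
      not-equal : ¬ (compareFin i i' ≡ same × compareFin j j' ≡ same)
      not-equal (i≡i' , j≡j') = t₁≢t₂ (cong₂ triangle (compareFin-same i i' i≡i') (compareFin-same j j' j≡j'))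

positions : ∀ {n} → Vec Bool n → ℕ → List ℕ
positions []          s = []
positions (true  ∷ v) s = s ∷ positions v (suc s)
positions (false ∷ v) s = positions v (suc s)

positions-above : ∀ {n} (v : Vec Bool n) s → All (s ≤_) (positions v s)
positions-above []          s = []
positions-above (true  ∷ v) s = ≤-refl ∷ All.map <⇒≤ (positions-above v (suc s))
positions-above (false ∷ v) s = All.map <⇒≤ (positions-above v (suc s))

positions-below : ∀ {n} (v : Vec Bool n) s → All (_< s + n) (positions v s)
positions-below []          s = []
positions-below {suc n} (true  ∷ v) s rewrite +-suc s n = s≤s (m≤m+n s n) ∷ positions-below v (suc s)
positions-below {suc n} (false ∷ v) s rewrite +-suc s n = positions-below v (suc s)

positions-sorted : ∀ {n} (v : Vec Bool n) s → AllPairs _<_ (positions v s)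
positions-sorted []          s = []
positions-sorted (true  ∷ v) s = positions-above v (suc s) ∷ positions-sorted v (suc s)
positions-sorted (false ∷ v) s = positions-sorted v (suc s)

positions-length : ∀ {n} (v : Vec Bool n) s → length (positions v s) ≡ ∣ v ∣
positions-length []          s = refl
positions-length (true  ∷ v) s = cong suc (positions-length v (suc s))
positions-length (false ∷ v) s = positions-length v (suc s)

¬head : ∀ {s P Q} → All (s <_) Q → s ∷ P ≢ Q
¬head (s<s ∷ _) refl = <-irrefl refl s<s

positions-injective : ∀ {n} (u v : Vec Bool n) s → positions u s ≡ positions v s → u ≡ v
positions-injective []          []          s eq = refl
positions-injective (true  ∷ u) (true  ∷ v) s eq =
  cong (true ∷_) (positions-injective u v (suc s) (∷-injectiveʳ eq))
positions-injective (true  ∷ u) (false ∷ v) s eq = ⊥-elim (¬head (positions-above v (suc s)) eq)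
positions-injective (false ∷ u) (true  ∷ v) s eq = ⊥-elim (¬head (positions-above u (suc s)) (sym eq))
positions-injective (false ∷ u) (false ∷ v) s eq = cong (false ∷_) (positions-injective u v (suc s) eq)

-- The label sequence of two sorted lists of points.  'mergeHead x rest ys'
-- is the merge of x ∷ xs with ys, given 'rest', the merge of xs with
-- anything; recursing on ys there keeps the definition structural.
mergeHead : ℕ → (List ℕ → List Lab) → List ℕ → List Lab
mergeHead x rest [] = L1 ∷ rest []
mergeHead x rest (y ∷ ys) with <-cmp x y
... | tri< _ _ _ = L1 ∷ rest (y ∷ ys)
... | tri≈ _ _ _ = LB ∷ rest ys
... | tri> _ _ _ = L2 ∷ mergeHead x rest ys

merge : List ℕ → List ℕ → List Lab
merge []       ys = map (λ _ → L2) ys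
merge (x ∷ xs) ys = mergeHead x (merge xs) ys

merge-< : ∀ {x y} xs ys → x < y → merge (x ∷ xs) (y ∷ ys) ≡ L1 ∷ merge xs (y ∷ ys)
merge-< {x} {y} xs ys x<y with <-cmp x y
... | tri< _ _ _    = refl
... | tri≈ x≮y _ _ = contradiction x<y x≮y
... | tri> x≮y _ _ = contradiction x<y x≮y

merge-≡ : ∀ x xs ys → merge (x ∷ xs) (x ∷ ys) ≡ LB ∷ merge xs ys
merge-≡ x xs ys with <-cmp x x
... | tri< _ x≢x _ = contradiction refl x≢x
... | tri≈ _ _ _    = refl
... | tri> _ x≢x _ = contradiction refl x≢x

merge-> : ∀ {x y} xs ys → y < x → merge (x ∷ xs) (y ∷ ys) ≡ L2 ∷ merge (x ∷ xs) ys
merge-> {x} {y} xs ys y<x with <-cmp x y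
... | tri< _ _ y≮x = contradiction y<x y≮x
... | tri≈ _ _ y≮x = contradiction y<x y≮x
... | tri> _ _ _    = refl

merge-headˡ : ∀ {x} xs {ys} → All (x <_) ys → merge (x ∷ xs) ys ≡ L1 ∷ merge xs ys
merge-headˡ xs []                = refl
merge-headˡ xs {_ ∷ ys} (x<y ∷ _) = merge-< xs ys x<y

merge-headʳ : ∀ {y} {xs} ys → All (y <_) xs → merge xs (y ∷ ys) ≡ L2 ∷ merge xs ys
merge-headʳ ys []                        = refl
merge-headʳ {xs = _ ∷ xs} ys (y<x ∷ _) = merge-> xs ys y<x

labelSeq-merge : ∀ {n} (u v : Vec Bool n) s → labelSeq u v ≡ merge (positions u s) (positions v s)
labelSeq-merge []          []          s = refl
labelSeq-merge (true  ∷ u) (true  ∷ v) s =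
  trans (cong (LB ∷_) (labelSeq-merge u v (suc s))) (sym (merge-≡ s (positions u (suc s)) (positions v (suc s))))
labelSeq-merge (true  ∷ u) (false ∷ v) s =
  trans (cong (L1 ∷_) (labelSeq-merge u v (suc s))) (sym (merge-headˡ (positions u (suc s)) (positions-above v (suc s))))
labelSeq-merge (false ∷ u) (true  ∷ v) s =
  trans (cong (L2 ∷_) (labelSeq-merge u v (suc s))) (sym (merge-headʳ (positions v (suc s)) (positions-above u (suc s))))
labelSeq-merge (false ∷ u) (false ∷ v) s = labelSeq-merge u v (suc s)

merge-nested : ∀ {a b c b' c'} → b < b' → b' < c' → c' < c →
    merge (a ∷ b ∷ c ∷ []) (a ∷ b' ∷ c' ∷ []) ≡ LB ∷ L1 ∷ L2 ∷ L2 ∷ L1 ∷ []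
  × merge (a ∷ b' ∷ c' ∷ []) (a ∷ b ∷ c ∷ []) ≡ LB ∷ L2 ∷ L1 ∷ L1 ∷ L2 ∷ []
merge-nested {a} {b} {c} {b'} {c'} b<b' b'<c' c'<c = outer , inner
  where
  b'<c = <-trans b'<c' c'<c
  outer = begin
    merge (a ∷ b ∷ c ∷ []) (a ∷ b' ∷ c' ∷ [])    ≡⟨ merge-≡ a (b ∷ c ∷ []) (b' ∷ c' ∷ []) ⟩
    LB ∷ merge (b ∷ c ∷ []) (b' ∷ c' ∷ [])       ≡⟨ cong (LB ∷_) (merge-< (c ∷ []) (c' ∷ []) b<b') ⟩
    LB ∷ L1 ∷ merge (c ∷ []) (b' ∷ c' ∷ [])      ≡⟨ cong (λ l → LB ∷ L1 ∷ l) (merge-> [] (c' ∷ []) b'<c) ⟩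
    LB ∷ L1 ∷ L2 ∷ merge (c ∷ []) (c' ∷ [])      ≡⟨ cong (λ l → LB ∷ L1 ∷ L2 ∷ l) (merge-> [] [] c'<c) ⟩
    LB ∷ L1 ∷ L2 ∷ L2 ∷ L1 ∷ []                  ∎
  inner = begin
    merge (a ∷ b' ∷ c' ∷ []) (a ∷ b ∷ c ∷ [])    ≡⟨ merge-≡ a (b' ∷ c' ∷ []) (b ∷ c ∷ []) ⟩
    LB ∷ merge (b' ∷ c' ∷ []) (b ∷ c ∷ [])       ≡⟨ cong (LB ∷_) (merge-> (c' ∷ []) (c ∷ []) b<b') ⟩
    LB ∷ L2 ∷ merge (b' ∷ c' ∷ []) (c ∷ [])      ≡⟨ cong (λ l → LB ∷ L2 ∷ l) (merge-< (c' ∷ []) [] b'<c) ⟩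
    LB ∷ L2 ∷ L1 ∷ merge (c' ∷ []) (c ∷ [])      ≡⟨ cong (λ l → LB ∷ L2 ∷ L1 ∷ l) (merge-< [] [] c'<c) ⟩
    LB ∷ L2 ∷ L1 ∷ L1 ∷ L2 ∷ []                  ∎

vertexList : ∀ {n} → Triangle n → List ℕ
vertexList (s , _) = positions s 0

labels≡merge : ∀ {n} (t₁ t₂ : Triangle n) → labels t₁ t₂ ≡ merge (vertexList t₁) (vertexList t₂)
labels≡merge t₁ t₂ = trans (labels≡labelSeq t₁ t₂) (labelSeq-merge (proj₁ t₁) (proj₁ t₂) 0)

vertexList-injective : ∀ {n} {t₁ t₂ : Triangle n} → vertexList t₁ ≡ vertexList t₂ → t₁ ≡ t₂
vertexList-injective {t₁ = u , p} {v , q} eq with positions-injective u v 0 eq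
... | refl = cong (u ,_) (≡-irrelevant p q)

record Vertices {n} (t : Triangle n) : Set where
  constructor mkVertices
  field
    a b c : ℕ
    a<b   : a < b
    b<c   : b < c
    c<n   : c < n
    list  : vertexList t ≡ a ∷ b ∷ c ∷ []

vertices : ∀ {n} (t : Triangle n) → Vertices t
vertices {n} t@(s , size) = fromList (vertexList t) refl (trans (positions-length s 0) size)
                                     (positions-sorted s 0) (positions-below s 0)
  where
  fromList : ∀ P → vertexList t ≡ P → length P ≡ 3 → AllPairs _<_ P → All (_< n) P → Vertices t
  fromList (a ∷ b ∷ c ∷ []) eq refl ((a<b ∷ _) ∷ (b<c ∷ _) ∷ _) (_ ∷ _ ∷ c<n ∷ _) =
    mkVertices a b c a<b b<c c<n eq

firstVertex : ∀ {n} {t : Triangle n} → Vertices t → Fin n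
firstVertex (mkVertices a b c a<b b<c c<n _) = fromℕ< (<-trans a<b (<-trans b<c c<n))

otherSum : ∀ {n} {t : Triangle n} → Vertices t → Fin (n + n)
otherSum (mkVertices a b c a<b b<c c<n _) = fromℕ< (+-mono-< (<-trans b<c c<n) c<n)

keyOf : ∀ {n} {t : Triangle n} → Vertices t → Fin (n * (n + n))
keyOf V = combine (firstVertex V) (otherSum V)

key : ∀ {n} → Triangle n → Fin (n * (n + n))
key t = keyOf (vertices t)

keyOf-parts : ∀ {n} {t₁ t₂ : Triangle n} (V₁ : Vertices t₁) (V₂ : Vertices t₂) → keyOf V₁ ≡ keyOf V₂ →
  Vertices.a V₁ ≡ Vertices.a V₂ × Vertices.b V₁ + Vertices.c V₁ ≡ Vertices.b V₂ + Vertices.c V₂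
keyOf-parts V₁@(mkVertices a b c _ _ _ _) V₂@(mkVertices a' b' c' _ _ _ _) key≡
  with combine-injective (firstVertex V₁) (otherSum V₁) (firstVertex V₂) (otherSum V₂) key≡
... | a≡a' , sum≡sum' = fromℕ<-injective a a' _ _ a≡a' , fromℕ<-injective (b + c) (b' + c') _ _ sum≡sum'

compensate : ∀ {b b' c c'} → b < b' → b + c ≡ b' + c' → c' < c
compensate b<b' sum≡ = ≰⇒> λ c≤c' → <-irrefl sum≡ (+-mono-<-≤ b<b' c≤c')

same-key⇒nested : ∀ {n} {t₁ t₂ : Triangle n} → t₁ ≢ t₂ → key t₁ ≡ key t₂ → Nested t₁ t₂
same-key⇒nested {t₁ = t₁} {t₂} t₁≢t₂ = nested (vertices t₁) (vertices t₂)
  where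
  nested : (V₁ : Vertices t₁) (V₂ : Vertices t₂) → keyOf V₁ ≡ keyOf V₂ → Nested t₁ t₂
  nested V₁@(mkVertices a b c _ b<c _ list₁) V₂@(mkVertices _ b' c' _ b'<c' _ list₂) key≡
    with keyOf-parts V₁ V₂ key≡
  ... | refl , sum≡ with <-cmp b b'
  ... | tri< b<b' _ _ = inj₁ ([] , _ , reads , refl)
    where
    reads = trans (labels≡merge t₁ t₂) (trans (cong₂ merge list₁ list₂)
                  (proj₁ (merge-nested b<b' b'<c' (compensate b<b' sum≡))))
  ... | tri≈ _ refl _ = ⊥-elim (t₁≢t₂ (vertexList-injective (trans list₁
                          (trans (cong (λ x → a ∷ b ∷ x ∷ []) (+-cancelˡ-≡ b c c' sum≡)) (sym list₂)))))
  ... | tri> _ _ b'<b = inj₂ ([] , _ , reads , refl)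
    where
    reads = trans (labels≡merge t₁ t₂) (trans (cong₂ merge list₁ list₂)
                  (proj₂ (merge-nested b'<b b<c (compensate b'<b (sym sum≡)))))

lookup-distinct : ∀ {A : Set} {xs : List A} → Unique xs →
  ∀ {i j : Fin (length xs)} → i Fin.< j → lookup xs i ≢ lookup xs j
lookup-distinct {xs = _ ∷ xs} (x∉xs ∷ _) {Fin.zero}  {Fin.suc j} _         = All.lookup x∉xs (∈-lookup j)
lookup-distinct {xs = _ ∷ xs} (_ ∷ unique) {Fin.suc i} {Fin.suc j} (s≤s i<j) = lookup-distinct unique i<j

length≤keys : ∀ {A : Set} {N} (f : A → Fin N) (xs : List A) → Unique xs →
  (∀ {x y} → x ∈ xs → y ∈ xs → x ≢ y → f x ≢ f y) → length xs ≤ N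
length≤keys {N = N} f xs unique separated with length xs ≤? N
... | yes fits = fits
... | no too-long with pigeonhole (≰⇒> too-long) (f ∘ lookup xs)
... | i , j , i<j , collide =
  contradiction collide (separated (∈-lookup i) (∈-lookup j) (lookup-distinct unique i<j))

upper-bound : ∀ {n} (F : List (Triangle n)) → Admissible F → length F ≤ n * (n + n)
upper-bound F (unique , free) = length≤keys key F unique
  λ t₁∈ t₂∈ t₁≢t₂ key≡ → free t₁∈ t₂∈ t₁≢t₂ (inj₂ (inj₁ (same-key⇒nested t₁≢t₂ key≡)))

divide-by-3 : ∀ n → ∃[ m ] ∃[ r ] (r < 3 × m + (m + (m + r)) ≡ n)
divide-by-3 n = n / 3 , n % 3 , m%n<n n 3 , trans (thrice (n / 3) (n % 3)) (sym (m≡m%n+[m/n]*n n 3))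
  where
  open +-*-Solver
  thrice : ∀ m r → m + (m + (m + r)) ≡ r + m * 3
  thrice = solve 2 (λ m r → m :+ (m :+ (m :+ r)) := r :+ m :* con 3) refl

square-bound : ∀ m r → r < 3 → 3 ≤ m + (m + (m + r)) →
  (m + (m + (m + r))) * (m + (m + (m + r))) ≤ 36 * (m * m)
square-bound zero r r<3 3≤r = contradiction r<3 (≤⇒≯ 3≤r)
square-bound m@(suc _) r r<3 _ = ≤-trans (*-mono-≤ n≤6m n≤6m) (≤-reflexive (square-6m m))
  where
  open +-*-Solver
  square-6m : ∀ m → 6 * m * (6 * m) ≡ 36 * (m * m)
  square-6m = solve 1 (λ m → con 6 :* m :* (con 6 :* m) := con 36 :* (m :* m)) refl
  sum-6m : ∀ m → m + (m + (m + 3 * m)) ≡ 6 * m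
  sum-6m = solve 1 (λ m → m :+ (m :+ (m :+ con 3 :* m)) := con 6 :* m) refl
  r≤3m : r ≤ 3 * m
  r≤3m = ≤-trans (<⇒≤ r<3) (*-monoʳ-≤ 3 (s≤s z≤n))
  n≤6m : m + (m + (m + r)) ≤ 6 * m
  n≤6m = ≤-trans (+-monoʳ-≤ m (+-monoʳ-≤ m (+-monoʳ-≤ m r≤3m))) (≤-reflexive (sum-6m m))

lower-bound : ∀ n → 3 ≤ n → ∃[ F ] (Admissible {n} F × n * n ≤ 36 * length F)
lower-bound n 3≤n with divide-by-3 n
... | m , r , r<3 , refl = family , family-admissible ,
  subst (λ k → (m + (m + (m + r))) * (m + (m + (m + r))) ≤ 36 * k) (sym family-length) (square-bound m r r<3 3≤n)
  where open LowerBound m r using (family; family-admissible; family-length)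

theorem21 : ∃[ c ] ∃[ C ] ∃[ N ] ∀ n → N ≤ n →
    (∃[ F ] (Admissible {n} F × n * n ≤ c * length F))
    × (∀ (F : List (Triangle n)) → Admissible F → length F ≤ C * (n * n))
theorem21 = 36 , 2 , 3 , λ n 3≤n →
  lower-bound n 3≤n ,
  λ F admissible → ≤-trans (upper-bound F admissible) (≤-reflexive (n·2n n))
  where
  open +-*-Solver
  n·2n : ∀ n → n * (n + n) ≡ 2 * (n * n)
  n·2n = solve 1 (λ n → n :* (n :+ n) := con 2 :* (n :* n)) refl
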